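{- Let $G_S$ be a connected undirected circulant graph on vertices $0,\dots,N-1$ with generating set $S$, bandwidth $M=\max S<N/2$, symmetric weights $d_j$ ($j=1,\dots,M$, $d_j=0$ for $j\notin S$) and adjacency matrix ${\bf A}$. For $\alpha\in\mathbb{C}$ let ${\bf L}_{\alpha}=d_{\alpha}{\bf I}_N-{\bf A}$ with $d_{\alpha}=\sum_{j=1}^M2d_j\cos(\alpha j)$, and let ${\bf L}_{C,\alpha}=2\cos(\alpha){\bf I}_N-{\bf A}_C$, where ${\bf A}_C$ is the adjacency matrix of the unweighted simple cycle. Then ${\bf L}_{\alpha}={\bf L}_{C,\alpha}{\bf P}_{\alpha}$, where ${\bf P}_{\alpha}$ is the symmetric circulant matrix of bandwidth $M-1$ with representer polynomial \[P_{\alpha}(z)=\sum_{j=1}^M d_j\Big(r_{j-1}+\sum_{t=1}^{j-1}r_{j-1-t}(z^t+z^{ -t})\Big),\] i.e. $P_{\alpha}(m,n)=q_{\delta}$ with $\delta=\min(|m-n|,N-|m-n|)$, $q_0=\sum_{j=1}^M d_jr_{j-1}$, $q_t=\sum_{j=t+1}^M d_jr_{j-1-t}$ for $1\le t\le M-1$, $q_t=0$ for $t\ge M$, where for odd $t$, $r_t=\sum_{k=0}^{(t+1)/2-1}2\cos(\alpha(2k-t))$, and for even $t$, $r_t=1+\sum_{k=0}^{t/2-1}2\cos(\alpha(2k-t))$.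
   Context: A circulant graph $G_S$ has an edge of weight $d_s$ between $i$ and $(i\pm s)\bmod N$ for each $s\in S$, so $A_{j,(j\pm i)\bmod N}=d_i$. ${\bf A}_C$ is the circulant matrix with first row $[0\ 1\ 0\ \dots\ 0\ 1]$. The representer polynomial of a symmetric circulant matrix with entries $q_{\delta(m,n)}$ is $q_0+\sum_{t\ge1}q_t(z^t+z^{ -t})$. -}

module Defs where

open import Level using (Level; _⊔_)
open import Algebra.Bundles using (CommutativeRing)
open import Data.Nat as ℕ using (ℕ; zero; suc; _∸_; _<ᵇ_; ∣_-_∣; _⊓_)
open import Data.Nat.Base using (_%_)
open import Data.Integer as ℤ using (ℤ; +_; -[1+_])
open import Data.Fin using (Fin; toℕ)
import Data.Fin as Fin
open import Data.Bool using (if_then_else_; _∧_)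
open import Data.List using (List)
open import Data.List.Membership.Propositional using (_∈_)

δ : (N : ℕ) → Fin N → Fin N → ℕ
δ N m n = ∣ toℕ m - toℕ n ∣ ⊓ (N ∸ ∣ toℕ m - toℕ n ∣)

-- G_S has an edge between i and (i ± s) mod N for s ∈ S; since max S < N/2
-- this is exactly: δ(i,j) ∈ S.
Edge : (N : ℕ) → List ℕ → Fin N → Fin N → Set
Edge N S x y = δ N x y ∈ S

data Reach (N : ℕ) (S : List ℕ) (x : Fin N) : Fin N → Set where
  here : Reach N S x x
  step : ∀ {y z} → Reach N S x y → Edge N S y z → Reach N S x z

Connected : (N : ℕ) → List ℕ → Set
Connected N S = ∀ x y → Reach N S x y

module _ {c ℓ : Level} (R : CommutativeRing c ℓ) where
  open CommutativeRing R

  Σ< : ℕ → (ℕ → Carrier) → Carrier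
  Σ< zero    f = 0#
  Σ< (suc n) f = Σ< n f + f n

  Σ[_to_] : ℕ → ℕ → (ℕ → Carrier) → Carrier
  Σ[ a to b ] f = Σ< (suc b ∸ a) (λ i → f (a ℕ.+ i))

  ΣFin : ∀ {N} → (Fin N → Carrier) → Carrier
  ΣFin {zero}  f = 0#
  ΣFin {suc N} f = f Fin.zero + ΣFin (λ i → f (Fin.suc i))

  Matrix : ℕ → Set c
  Matrix N = Fin N → Fin N → Carrier

  _⊛_ : ∀ {N} → Matrix N → Matrix N → Matrix N
  (X ⊛ Y) i k = ΣFin (λ j → X i j * Y j k)

  _≈M_ : ∀ {N} → Matrix N → Matrix N → Set ℓ
  X ≈M Y = ∀ i j → X i j ≈ Y i j

  _⊖_ : ∀ {N} → Matrix N → Matrix N → Matrix N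
  (X ⊖ Y) i j = X i j - Y i j

  scalarI : ∀ {N} → Carrier → Matrix N
  scalarI a i j = if toℕ i ℕ.≡ᵇ toℕ j then a else 0#

  circ : (N : ℕ) → (ℕ → Carrier) → Matrix N
  circ N q m n = q (δ N m n)

  -- weighted adjacency matrix of G_S: A_{m,(m±i) mod N} = d_i (1 ≤ i ≤ M)
  adjacency : (N M : ℕ) → (ℕ → Carrier) → Matrix N
  adjacency N M d = circ N (λ t → if (0 <ᵇ t) ∧ (t <ᵇ suc M) then d t else 0#)

  cycleAdj : (N : ℕ) → Matrix N
  cycleAdj N = circ N (λ t → if t ℕ.≡ᵇ 1 then 1# else 0#)

  -- Complex parameter α is encoded by the unit u = e^{iα} with inverse v = e^{-iα};
  -- e^{iαk} for k ∈ ℤ: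
  pow : Carrier → ℕ → Carrier
  pow x zero    = 1#
  pow x (suc n) = x * pow x n

  expI : Carrier → Carrier → ℤ → Carrier
  expI u v (+ n)      = pow u n
  expI u v -[1+ n ]   = pow v (suc n)

  -- 2 cos(α k) = e^{iαk} + e^{-iαk}
  twoCos : Carrier → Carrier → ℤ → Carrier
  twoCos u v k = expI u v k + expI u v (ℤ.- k)

  dα : Carrier → Carrier → ℕ → (ℕ → Carrier) → Carrier
  dα u v M d = Σ[ 1 to M ] (λ j → d j * twoCos u v (+ j))

  r : Carrier → Carrier → ℕ → Carrier
  r u v t = if t % 2 ℕ.≡ᵇ 1
            then Σ< ((suc t) ℕ./ 2) (λ k → twoCos u v (+ (2 ℕ.* k) ℤ.- + t))
            else 1# + Σ< (t ℕ./ 2) (λ k → twoCos u v (+ (2 ℕ.* k) ℤ.- + t))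

  q : Carrier → Carrier → ℕ → (ℕ → Carrier) → ℕ → Carrier
  q u v M d t = if t <ᵇ M
                then Σ[ suc t to M ] (λ j → d j * r u v (j ∸ 1 ∸ t))
                else 0#

  Lα : (N M : ℕ) → (ℕ → Carrier) → Carrier → Carrier → Matrix N
  Lα N M d u v = scalarI (dα u v M d) ⊖ adjacency N M d

  LCα : (N : ℕ) → Carrier → Carrier → Matrix N
  LCα N u v = scalarI (twoCos u v (+ 1)) ⊖ cycleAdj N

  Pα : (N M : ℕ) → (ℕ → Carrier) → Carrier → Carrier → Matrix N
  Pα N M d u v = circ N (q u v M d)

module Submission where

open import Defs
open import Level using (Level)
open import Algebra.Bundles using (CommutativeRing)
open import Data.Nat using (ℕ; _≤_; _<_) renaming (_+_ to _+ℕ_)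
open import Data.Product using (_×_)
open import Data.List using (List)
open import Data.List.Membership.Propositional using (_∈_; _∉_)

open import Data.Nat using (zero; suc; _∸_; _≡ᵇ_; _<ᵇ_; z≤n; s≤s; NonZero; >-nonZero) renaming (_*_ to _*ℕ_)
import Data.Nat as ℕ
import Data.Nat.Properties as ℕₚ
open import Data.Nat.DivMod using (_%_; _/_; [m+n]%n≡m%n; m<n⇒m%n≡m; m/n≡1+[m∸n]/n)
open import Data.Integer using (+_) renaming (_-_ to _-ℤ_; _⊖_ to _⊖ℤ_)
import Data.Integer.Properties as ℤₚ
open import Data.Fin using (Fin; toℕ)
import Data.Fin.Properties as Finₚ
open import Data.Bool using (true; false; T; if_then_else_; _∧_)
open import Data.Unit using (tt)
open import Data.Empty using (⊥-elim)
open import Data.Product using (_,_; proj₁; proj₂)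
open import Data.Sum using (_⊎_; inj₁; inj₂)
open import Function using (_∘_)
open import Relation.Nullary using (¬_; yes; no)
open import Relation.Binary.PropositionalEquality as ≡ using (_≡_; _≢_)

-- The identity is proved entrywise over an arbitrary commutative ring in which
-- u = e^{iα} and v = e^{−iα} are mutually inverse, so that 2cos(kα) = u^k + v^k.
-- Entry (a, b) of L_{C,α} P_α is 2cos α · q_s − q_{s⁺} − q_{s⁻}, where s, s⁺, s⁻ are
-- the cyclic distances from b to a, a + 1, a − 1 (Cycle, CycleLaplacian). Either a = b,
-- and s = 0, s⁺ = s⁻ = 1; or {s⁺, s⁻} = {s − 1, ∥s + 1∥}, where ∥s + 1∥ differs from
-- s + 1 only past the half-way point of the cycle, where q already vanishes since 2M < N.
-- The sums r_t are Chebyshev polynomials of the second kind in 2cos α, so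
-- 2cos α · r_t = r_{t+1} + r_{t−1} with r_{−1} = 0 (Chebyshev). Summation by parts
-- against this recurrence turns the two cases into 2cos α · q₀ − 2q₁ = d_α and
-- 2cos α · q_{s+1} − q_s − q_{s+2} = −d_{s+1} (Coefficients), which are exactly the
-- entries of L_α (Assembly).

SamePair : ℕ → ℕ → ℕ → ℕ → Set
SamePair p q x y = (p ≡ x × q ≡ y) ⊎ (p ≡ y × q ≡ x)

module Cycle where
  open import Data.Nat using (_+_; _⊓_; ∣_-_∣; >-nonZero⁻¹)
  open import Data.Nat.Properties
  open import Data.Nat.DivMod using (n%n≡0; m%n%n≡m%n; %-distribˡ-+; m%n<n)
  open import Relation.Binary.PropositionalEquality
  open import Data.Nat.Solver using (module +-*-Solver)

  half-< : ∀ {x y} → x + x < y + y → x < y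
  half-< {x} {y} x+x<y+y with x <? y
  ... | yes x<y = x<y
  ... | no x≮y = ⊥-elim (<⇒≱ x+x<y+y (+-mono-≤ (≮⇒≥ x≮y) (≮⇒≥ x≮y)))

  +-interchange : ∀ a b c d → (a + c) + (b + d) ≡ (a + b) + (c + d)
  +-interchange = solve 4 (λ a b c d → (a :+ c) :+ (b :+ d) := (a :+ b) :+ (c :+ d)) refl
    where open +-*-Solver

  complement-pred : ∀ {e f n} → e + f ≡ n → 0 < e → e ∸ 1 ≡ n ∸ suc f
  complement-pred {suc e} {f} refl _ = sym (m+n∸n≡m e f)

  complement-suc : ∀ {e f n} → e + f ≡ n → 0 < f → suc e ≡ n ∸ (f ∸ 1)
  complement-suc {e} {suc f} refl _ = sym (trans (cong (_∸ f) (+-suc e f)) (m+n∸n≡m (suc e) f))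

  module CycleGeometry (N : ℕ) {{_ : NonZero N}} where

    ∥_∥ : ℕ → ℕ
    ∥ e ∥ = e ⊓ (N ∸ e)

    -- graph distance on C_N; δ N m n is definitionally dist (toℕ m) (toℕ n)
    dist : ℕ → ℕ → ℕ
    dist a b = ∥ ∣ a - b ∣ ∥

    ∥∥-small : ∀ {t} → t + t ≤ N → ∥ t ∥ ≡ t
    ∥∥-small {t} h = m≤n⇒m⊓n≡m (m+n≤o⇒m≤o∸n t h)

    ∥∥-reflect : ∀ {t} → t ≤ N → ∥ N ∸ t ∥ ≡ ∥ t ∥
    ∥∥-reflect {t} h = trans (cong ((N ∸ t) ⊓_) (m∸[m∸n]≡n h)) (⊓-comm (N ∸ t) t)

    ∥∥-half : ∀ {t} → t ≤ N → ∥ t ∥ + ∥ t ∥ ≤ N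
    ∥∥-half {t} h = ≤-trans (+-mono-≤ (m⊓n≤m t (N ∸ t)) (m⊓n≤n t (N ∸ t))) (≤-reflexive (m+[n∸m]≡n h))

    ∥∥-positive : ∀ {e} → 0 < e → e < N → 0 < ∥ e ∥
    ∥∥-positive e>0 e<N = ⊓-glb e>0 (m<n⇒0<n∸m e<N)

    _⊝_ : ℕ → ℕ → ℕ
    a ⊝ b = (a + (N ∸ b)) % N

    ⊝-cases : ∀ {a b} → a < N → b < N →
              (b ≤ a × a ⊝ b ≡ a ∸ b) ⊎ (a < b × a ⊝ b ≡ N ∸ (b ∸ a))
    ⊝-cases {a} {b} a<N b<N with b ≤? a
    ... | yes b≤a = inj₁ (b≤a , (begin
          (a + (N ∸ b)) % N        ≡⟨ cong (λ x → (x + (N ∸ b)) % N) (sym (m∸n+n≡m b≤a)) ⟩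
          (a ∸ b + b + (N ∸ b)) % N ≡⟨ cong (_% N) (+-assoc (a ∸ b) b (N ∸ b)) ⟩
          (a ∸ b + (b + (N ∸ b))) % N ≡⟨ cong (λ x → (a ∸ b + x) % N) (m+[n∸m]≡n (<⇒≤ b<N)) ⟩
          (a ∸ b + N) % N          ≡⟨ [m+n]%n≡m%n (a ∸ b) N ⟩
          (a ∸ b) % N              ≡⟨ m<n⇒m%n≡m (≤-<-trans (m∸n≤m a b) a<N) ⟩
          a ∸ b                    ∎))
      where open ≡-Reasoning
    ... | no b≰a = inj₂ (a<b , trans (m<n⇒m%n≡m sum<N) (begin
          a + (N ∸ b)                   ≡⟨ sym (m+n∸m≡n (b ∸ a) _) ⟩
          b ∸ a + (a + (N ∸ b)) ∸ (b ∸ a) ≡⟨ cong (_∸ (b ∸ a)) (sym (+-assoc (b ∸ a) a (N ∸ b))) ⟩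
          b ∸ a + a + (N ∸ b) ∸ (b ∸ a) ≡⟨ cong (λ x → x + (N ∸ b) ∸ (b ∸ a)) (m∸n+n≡m (<⇒≤ a<b)) ⟩
          b + (N ∸ b) ∸ (b ∸ a)         ≡⟨ cong (_∸ (b ∸ a)) (m+[n∸m]≡n (<⇒≤ b<N)) ⟩
          N ∸ (b ∸ a)                   ∎))
      where
      open ≡-Reasoning
      a<b : a < b
      a<b = ≰⇒> b≰a
      sum<N : a + (N ∸ b) < N
      sum<N = subst (a + (N ∸ b) <_) (m+[n∸m]≡n (<⇒≤ b<N)) (+-monoˡ-< (N ∸ b) a<b)

    dist-⊝ : ∀ {a b} → a < N → b < N → dist a b ≡ ∥ a ⊝ b ∥
    dist-⊝ {a} {b} a<N b<N with ⊝-cases a<N b<N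
    ... | inj₁ (b≤a , eq) rewrite eq | m≤n⇒∣n-m∣≡n∸m b≤a = refl
    ... | inj₂ (a<b , eq) rewrite eq | m≤n⇒∣m-n∣≡n∸m (<⇒≤ a<b) =
          sym (∥∥-reflect (≤-trans (m∸n≤m b a) (<⇒≤ b<N)))

    ⊝-self : ∀ {a} → a < N → a ⊝ a ≡ 0
    ⊝-self {a} a<N = trans (cong (_% N) (m+[n∸m]≡n (<⇒≤ a<N))) (n%n≡0 N)

    ⊝-zero : ∀ {a b} → a < N → b < N → a ⊝ b ≡ 0 → a ≡ b
    ⊝-zero {a} {b} a<N b<N a⊝b≡0 with ⊝-cases a<N b<N
    ... | inj₁ (b≤a , eq) = ≤-antisym (m∸n≡0⇒m≤n (trans (sym eq) a⊝b≡0)) b≤a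
    ... | inj₂ (a<b , eq) =
          ⊥-elim (<⇒≱ (≤-<-trans (m∸n≤m b a) b<N) (m∸n≡0⇒m≤n (trans (sym eq) a⊝b≡0)))

    %-absorbˡ : ∀ x y → (x % N + y) % N ≡ (x + y) % N
    %-absorbˡ x y = begin
      (x % N + y) % N           ≡⟨ %-distribˡ-+ (x % N) y N ⟩
      (x % N % N + y % N) % N   ≡⟨ cong (λ z → (z + y % N) % N) (m%n%n≡m%n x N) ⟩
      (x % N + y % N) % N       ≡⟨ sym (%-distribˡ-+ x y N) ⟩
      (x + y) % N               ∎
      where open ≡-Reasoning

    ⊝-shift : ∀ a b z → ((a + z) % N) ⊝ b ≡ (a ⊝ b + z) % N
    ⊝-shift a b z = begin
      ((a + z) % N + (N ∸ b)) % N ≡⟨ %-absorbˡ (a + z) (N ∸ b) ⟩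
      (a + z + (N ∸ b)) % N       ≡⟨ cong (_% N) (+-assoc a z (N ∸ b)) ⟩
      (a + (z + (N ∸ b))) % N     ≡⟨ cong (λ x → (a + x) % N) (+-comm z (N ∸ b)) ⟩
      (a + ((N ∸ b) + z)) % N     ≡⟨ cong (_% N) (sym (+-assoc a (N ∸ b) z)) ⟩
      (a + (N ∸ b) + z) % N       ≡⟨ sym (%-absorbˡ (a + (N ∸ b)) z) ⟩
      (a ⊝ b + z) % N             ∎
      where open ≡-Reasoning

    ∥suc∥-mod : ∀ {e} → e < N → ∥ (e + 1) % N ∥ ≡ ∥ suc e ∥
    ∥suc∥-mod {e} e<N with suc e <? N
    ... | yes e+1<N = cong ∥_∥ (trans (cong (_% N) (+-comm e 1)) (m<n⇒m%n≡m e+1<N))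
    ... | no e+1≮N = begin
      ∥ (e + 1) % N ∥ ≡⟨ cong (λ x → ∥ x % N ∥) (trans (+-comm e 1) e+1≡N) ⟩
      ∥ N % N ∥       ≡⟨ cong ∥_∥ (n%n≡0 N) ⟩
      0               ≡⟨ sym (trans (cong (N ⊓_) (n∸n≡0 N)) (⊓-zeroʳ N)) ⟩
      ∥ N ∥           ≡⟨ cong ∥_∥ (sym e+1≡N) ⟩
      ∥ suc e ∥       ∎
      where
      open ≡-Reasoning
      e+1≡N : suc e ≡ N
      e+1≡N = ≤-antisym e<N (≮⇒≥ e+1≮N)

    pred-mod : ∀ {e} → 0 < e → e < N → (e + (N ∸ 1)) % N ≡ e ∸ 1
    pred-mod {suc e} _ e<N = begin
      (suc e + (N ∸ 1)) % N ≡⟨ cong (_% N) (sym (+-suc e (N ∸ 1))) ⟩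
      (e + suc (N ∸ 1)) % N ≡⟨ cong (λ x → (e + x) % N) (m+[n∸m]≡n (>-nonZero⁻¹ N)) ⟩
      (e + N) % N           ≡⟨ [m+n]%n≡m%n e N ⟩
      e % N                 ≡⟨ m<n⇒m%n≡m (<-trans (n<1+n e) e<N) ⟩
      e                     ∎
      where open ≡-Reasoning

    neighbours : ∀ {e} → 0 < e → e < N →
                 SamePair (∥ suc e ∥) (∥ e ∸ 1 ∥) (∥ suc ∥ e ∥ ∥) (∥ e ∥ ∸ 1)
    neighbours {e} e>0 e<N with e + e ≤? N
    ... | yes e+e≤N = inj₁ (cong (λ x → ∥ suc x ∥) (sym ∥e∥≡e) ,
          trans (∥∥-small (≤-trans (+-mono-≤ (m∸n≤m e 1) (m∸n≤m e 1)) e+e≤N)) (cong (_∸ 1) (sym ∥e∥≡e)))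
      where
      ∥e∥≡e : ∥ e ∥ ≡ e
      ∥e∥≡e = ∥∥-small e+e≤N
    ... | no e+e≰N = inj₂ (∥suc-e∥ , ∥e-1∥)
      where
      open ≡-Reasoning
      f = N ∸ e
      e+f≡N : e + f ≡ N
      e+f≡N = m+[n∸m]≡n (<⇒≤ e<N)
      f<e : f < e
      f<e = +-cancelˡ-< e f e (subst (_< e + e) (sym e+f≡N) (≰⇒> e+e≰N))
      f+f≤N : f + f ≤ N
      f+f≤N = subst (f + f ≤_) (trans (+-comm f e) e+f≡N) (+-monoʳ-≤ f (<⇒≤ f<e))
      ∥e∥≡f : ∥ e ∥ ≡ f
      ∥e∥≡f = m≥n⇒m⊓n≡n (<⇒≤ f<e)
      ∥suc-e∥ : ∥ suc e ∥ ≡ ∥ e ∥ ∸ 1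
      ∥suc-e∥ = begin
        ∥ suc e ∥       ≡⟨ cong ∥_∥ (complement-suc e+f≡N (m<n⇒0<n∸m e<N)) ⟩
        ∥ N ∸ (f ∸ 1) ∥ ≡⟨ ∥∥-reflect (≤-trans (m∸n≤m f 1) (m∸n≤m N e)) ⟩
        ∥ f ∸ 1 ∥       ≡⟨ ∥∥-small (≤-trans (+-mono-≤ (m∸n≤m f 1) (m∸n≤m f 1)) f+f≤N) ⟩
        f ∸ 1           ≡⟨ cong (_∸ 1) (sym ∥e∥≡f) ⟩
        ∥ e ∥ ∸ 1       ∎
      ∥e-1∥ : ∥ e ∸ 1 ∥ ≡ ∥ suc ∥ e ∥ ∥
      ∥e-1∥ = begin
        ∥ e ∸ 1 ∥       ≡⟨ cong ∥_∥ (complement-pred e+f≡N e>0) ⟩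
        ∥ N ∸ suc f ∥   ≡⟨ ∥∥-reflect (≤-trans f<e (<⇒≤ e<N)) ⟩
        ∥ suc f ∥       ≡⟨ cong (λ x → ∥ suc x ∥) (sym ∥e∥≡f) ⟩
        ∥ suc ∥ e ∥ ∥   ∎

    dist-shift : ∀ {a b} z → a < N → b < N → dist ((a + z) % N) b ≡ ∥ (a ⊝ b + z) % N ∥
    dist-shift {a} {b} z a<N b<N =
      trans (dist-⊝ (m%n<n (a + z) N) b<N) (cong ∥_∥ (⊝-shift a b z))

    neighbours-of-self : ∀ {a} → a < N →
      dist ((a + 1) % N) a ≡ ∥ 1 ∥ × dist ((a + (N ∸ 1)) % N) a ≡ ∥ 1 ∥
    neighbours-of-self {a} a<N =
        trans (dist-shift 1 a<N a<N)
              (trans (cong (λ x → ∥ (x + 1) % N ∥) (⊝-self a<N)) (∥suc∥-mod (>-nonZero⁻¹ N)))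
      , (begin
        dist ((a + (N ∸ 1)) % N) a ≡⟨ dist-shift (N ∸ 1) a<N a<N ⟩
        ∥ (a ⊝ a + (N ∸ 1)) % N ∥  ≡⟨ cong (λ x → ∥ (x + (N ∸ 1)) % N ∥) (⊝-self a<N) ⟩
        ∥ (N ∸ 1) % N ∥            ≡⟨ cong ∥_∥ (m<n⇒m%n≡m (∸-monoʳ-< (s≤s z≤n) (>-nonZero⁻¹ N))) ⟩
        ∥ N ∸ 1 ∥                  ≡⟨ ∥∥-reflect (>-nonZero⁻¹ N) ⟩
        ∥ 1 ∥                      ∎)
      where open ≡-Reasoning

    neighbours-of-other : ∀ {a b} → a < N → b < N → a ≢ b →
      let s = dist a b in
      0 < s × s + s ≤ N ×
      SamePair (dist ((a + 1) % N) b) (dist ((a + (N ∸ 1)) % N) b) (∥ suc s ∥) (s ∸ 1)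
    neighbours-of-other {a} {b} a<N b<N a≢b =
      subst (0 <_) (sym s≡) (∥∥-positive e>0 e<N) ,
      subst (λ x → x + x ≤ N) (sym s≡) (∥∥-half (<⇒≤ e<N)) ,
      subst₂ (λ x y → SamePair s⁺ s⁻ (∥ suc x ∥) (y ∸ 1)) (sym s≡) (sym s≡)
             (subst₂ (λ x y → SamePair x y (∥ suc ∥ e ∥ ∥) (∥ e ∥ ∸ 1)) (sym s⁺≡) (sym s⁻≡) (neighbours e>0 e<N))
      where
      s⁺ = dist ((a + 1) % N) b
      s⁻ = dist ((a + (N ∸ 1)) % N) b
      e = a ⊝ b
      e<N : e < N
      e<N = m%n<n (a + (N ∸ b)) N
      e>0 : 0 < e
      e>0 = n≢0⇒n>0 (λ e≡0 → a≢b (⊝-zero a<N b<N e≡0))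
      s≡ : dist a b ≡ ∥ e ∥
      s≡ = dist-⊝ a<N b<N
      s⁺≡ : dist ((a + 1) % N) b ≡ ∥ suc e ∥
      s⁺≡ = trans (dist-shift 1 a<N b<N) (∥suc∥-mod e<N)
      s⁻≡ : dist ((a + (N ∸ 1)) % N) b ≡ ∥ e ∸ 1 ∥
      s⁻≡ = trans (dist-shift (N ∸ 1) a<N b<N) (cong ∥_∥ (pred-mod e>0 e<N))

    -- Past the half-way point the norm of s + 1 wraps around, but then it is
    -- already beyond any bandwidth M with 2M < N.
    norm-suc-wraps-beyond : ∀ {s M} → s + s ≤ N → M + M < N →
      ∥ suc s ∥ ≡ suc s ⊎ (M ≤ suc s × M ≤ ∥ suc s ∥)
    norm-suc-wraps-beyond {s} {M} s+s≤N M+M<N with suc s ≤? N ∸ suc s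
    ... | yes s+1≤N-s-1 = inj₁ (m≤n⇒m⊓n≡m s+1≤N-s-1)
    ... | no s+1≰N-s-1 = inj₂ (M≤s+1 , ⊓-glb M≤s+1 M≤N-s-1)
      where
      M+s<N : M + s < N
      M+s<N = half-< (subst (_< N + N) (+-interchange M s M s) (+-mono-<-≤ M+M<N s+s≤N))
      M≤N-s-1 : M ≤ N ∸ suc s
      M≤N-s-1 = m+n≤o⇒m≤o∸n M (subst (_≤ N) (sym (+-suc M s)) M+s<N)
      M≤s+1 : M ≤ suc s
      M≤s+1 = <⇒≤ (≤-<-trans M≤N-s-1 (≰⇒> s+1≰N-s-1))

    dist-comm : ∀ a b → dist a b ≡ dist b a
    dist-comm a b = cong ∥_∥ (∣-∣-comm a b)

    dist-rotate : ∀ {a e} → a < N → e < N → dist a ((a + e) % N) ≡ ∥ e ∥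
    dist-rotate {a} {e} a<N e<N = begin
      dist a ((a + e) % N)   ≡⟨ dist-comm a _ ⟩
      dist ((a + e) % N) a   ≡⟨ dist-shift e a<N a<N ⟩
      ∥ (a ⊝ a + e) % N ∥    ≡⟨ cong (λ x → ∥ (x + e) % N ∥) (⊝-self a<N) ⟩
      ∥ e % N ∥              ≡⟨ cong ∥_∥ (m<n⇒m%n≡m e<N) ⟩
      ∥ e ∥                  ∎
      where open ≡-Reasoning

    dist-self : ∀ a → dist a a ≡ 0
    dist-self a = cong ∥_∥ (∣n-n∣≡0 a)

open Cycle using (module CycleGeometry)

if-true : ∀ {a} {A : Set a} {b} {x y : A} → T b → (if b then x else y) ≡ x
if-true {b = true} _ = ≡.refl

if-false : ∀ {a} {A : Set a} {b} {x y : A} → ¬ T b → (if b then x else y) ≡ y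
if-false {b = false} _ = ≡.refl
if-false {b = true} ¬t = ⊥-elim (¬t tt)

module FiniteSums {c ℓ : Level} (R : CommutativeRing c ℓ) where
  open CommutativeRing R
  open import Relation.Binary.Reasoning.Setoid setoid
  open import Algebra.Solver.Ring.NaturalCoefficients.Default commutativeSemiring
    using (solve; _:=_; _:+_)
  import Algebra.Properties.AbelianGroup +-abelianGroup as AbelianGroupProperties

  Σ : ℕ → (ℕ → Carrier) → Carrier
  Σ = Σ< R

  Σ-head : ∀ n f → Σ (suc n) f ≈ f 0 + Σ n (f ∘ suc)
  Σ-head zero f = trans (+-identityˡ _) (sym (+-identityʳ _))
  Σ-head (suc n) f = trans (+-congʳ (Σ-head n f)) (+-assoc _ _ _)

  Σ-cong : ∀ n {f g} → (∀ i → i < n → f i ≈ g i) → Σ n f ≈ Σ n g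
  Σ-cong zero f≈g = refl
  Σ-cong (suc n) f≈g = +-cong (Σ-cong n (λ i i<n → f≈g i (ℕₚ.m<n⇒m<1+n i<n))) (f≈g n ℕₚ.≤-refl)

  Σ-length : ∀ {m n} f → m ≡ n → Σ m f ≈ Σ n f
  Σ-length f ≡.refl = refl

  Σ-zero : ∀ n {f} → (∀ i → i < n → f i ≈ 0#) → Σ n f ≈ 0#
  Σ-zero n f≈0 = trans (Σ-cong n f≈0) (Σ-const-0 n)
    where
    Σ-const-0 : ∀ n → Σ n (λ _ → 0#) ≈ 0#
    Σ-const-0 zero = refl
    Σ-const-0 (suc n) = trans (+-identityʳ _) (Σ-const-0 n)

  Σ-+ : ∀ n f g → Σ n (λ i → f i + g i) ≈ Σ n f + Σ n g
  Σ-+ zero f g = sym (+-identityˡ 0#)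
  Σ-+ (suc n) f g = trans (+-congʳ (Σ-+ n f g))
    (solve 4 (λ a b x y → (a :+ b) :+ (x :+ y) := (a :+ x) :+ (b :+ y)) refl _ _ _ _)

  Σ-*ˡ : ∀ n x f → Σ n (λ i → x * f i) ≈ x * Σ n f
  Σ-*ˡ zero x f = sym (zeroʳ x)
  Σ-*ˡ (suc n) x f = trans (+-congʳ (Σ-*ˡ n x f)) (sym (distribˡ x _ _))

  Σ-neg : ∀ n f → Σ n (λ i → - f i) ≈ - Σ n f
  Σ-neg zero f = sym (AbelianGroupProperties.ε⁻¹≈ε)
  Σ-neg (suc n) f = trans (+-congʳ (Σ-neg n f)) (AbelianGroupProperties.⁻¹-∙-comm _ _)

  Σ-split : ∀ m n f → Σ (m +ℕ n) f ≈ Σ m f + Σ n (λ i → f (m +ℕ i))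
  Σ-split m zero f = trans (Σ-length f (ℕₚ.+-identityʳ m)) (sym (+-identityʳ _))
  Σ-split m (suc n) f =
    trans (Σ-length f (ℕₚ.+-suc m n)) (trans (+-congʳ (Σ-split m n f)) (+-assoc _ _ _))

  ΣFin-toℕ : ∀ n (f : ℕ → Carrier) → ΣFin R {n} (f ∘ toℕ) ≈ Σ n f
  ΣFin-toℕ zero f = refl
  ΣFin-toℕ (suc n) f = trans (+-congˡ (ΣFin-toℕ n (f ∘ suc))) (sym (Σ-head n f))

  kronecker : ℕ → ℕ → Carrier → Carrier
  kronecker a b x = if a ≡ᵇ b then x else 0#

  kronecker-≡ : ∀ a x → kronecker a a x ≈ x
  kronecker-≡ a x = reflexive (if-true (ℕₚ.≡⇒≡ᵇ a a ≡.refl))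

  kronecker-≢ : ∀ {a b} x → a ≢ b → kronecker a b x ≈ 0#
  kronecker-≢ {a} {b} x a≢b = reflexive (if-false (λ t → a≢b (ℕₚ.≡ᵇ⇒≡ a b t)))

  Σ-kronecker : ∀ n {a} → a < n → (x : Carrier) (f : ℕ → Carrier) → Σ n (λ b → kronecker a b x * f b) ≈ x * f a
  Σ-kronecker (suc n) {a} a<1+n x f with a ℕₚ.≟ n
  ... | yes ≡.refl = trans (+-cong (Σ-zero a off-diagonal) (*-congʳ (kronecker-≡ a x))) (+-identityˡ _)
    where
    off-diagonal : ∀ b → b < a → kronecker a b x * f b ≈ 0#
    off-diagonal b b<a = trans (*-congʳ (kronecker-≢ x (λ a≡b → ℕₚ.<-irrefl (≡.sym a≡b) b<a))) (zeroˡ _)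
  ... | no a≢n = trans (+-cong (Σ-kronecker n (ℕₚ.≤∧≢⇒< (ℕₚ.≤-pred a<1+n) a≢n) x f) last-zero) (+-identityʳ _)
    where
    last-zero : kronecker a n x * f n ≈ 0#
    last-zero = trans (*-congʳ (kronecker-≢ x a≢n)) (zeroˡ _)

  Σ-rotate : ∀ N {{_ : NonZero N}} {a} → a < N → ∀ f → Σ N f ≈ Σ N (λ e → f ((a +ℕ e) % N))
  Σ-rotate N {a} a<N f = begin
    Σ N f                                      ≈⟨ Σ-length f (≡.sym a+t≡N) ⟩
    Σ (a +ℕ t) f                                ≈⟨ Σ-split a t f ⟩
    Σ a f + Σ t (λ i → f (a +ℕ i))              ≈⟨ +-comm _ _ ⟩
    Σ t (λ i → f (a +ℕ i)) + Σ a f              ≈⟨ sym (+-cong (Σ-cong t below-wrap) (Σ-cong a above-wrap)) ⟩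
    Σ t g + Σ a (λ i → g (t +ℕ i))              ≈⟨ sym (Σ-split t a g) ⟩
    Σ (t +ℕ a) g                                ≈⟨ Σ-length g (≡.trans (ℕₚ.+-comm t a) a+t≡N) ⟩
    Σ N g                                      ∎
    where
    t = N ∸ a
    a+t≡N : a +ℕ t ≡ N
    a+t≡N = ℕₚ.m+[n∸m]≡n (ℕₚ.<⇒≤ a<N)
    g : ℕ → Carrier
    g e = f ((a +ℕ e) % N)
    below-wrap : ∀ i → i < t → g i ≈ f (a +ℕ i)
    below-wrap i i<t = reflexive (≡.cong f (m<n⇒m%n≡m (≡.subst (a +ℕ i <_) a+t≡N (ℕₚ.+-monoʳ-< a i<t))))
    above-wrap : ∀ i → i < a → g (t +ℕ i) ≈ f i
    above-wrap i i<a = reflexive (≡.cong f (≡.trans (≡.cong (_% N) shift)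
                              (≡.trans ([m+n]%n≡m%n i N) (m<n⇒m%n≡m (ℕₚ.<-trans i<a a<N)))))
      where
      shift : a +ℕ (t +ℕ i) ≡ i +ℕ N
      shift = ≡.trans (≡.sym (ℕₚ.+-assoc a t i)) (≡.trans (≡.cong (_+ℕ i) a+t≡N) (ℕₚ.+-comm N i))

2[k+1]-[t+2] : ∀ k t → + (2 *ℕ suc k) -ℤ + suc (suc t) ≡ + (2 *ℕ k) -ℤ + t
2[k+1]-[t+2] k t = begin
  + (2 *ℕ suc k) -ℤ + suc (suc t)         ≡⟨ ≡.cong (λ z → + z -ℤ + suc (suc t)) (ℕₚ.*-suc 2 k) ⟩
  + suc (suc (2 *ℕ k)) -ℤ + suc (suc t)   ≡⟨ ℤₚ.m-n≡m⊖n (suc (suc (2 *ℕ k))) (suc (suc t)) ⟩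
  suc (suc (2 *ℕ k)) ⊖ℤ suc (suc t)        ≡⟨ ℤₚ.[1+m]⊖[1+n]≡m⊖n (suc (2 *ℕ k)) (suc t) ⟩
  suc (2 *ℕ k) ⊖ℤ suc t                    ≡⟨ ℤₚ.[1+m]⊖[1+n]≡m⊖n (2 *ℕ k) t ⟩
  2 *ℕ k ⊖ℤ t                             ≡⟨ ≡.sym (ℤₚ.m-n≡m⊖n (2 *ℕ k) t) ⟩
  + (2 *ℕ k) -ℤ + t                       ∎
  where open ≡.≡-Reasoning

module Chebyshev {c ℓ : Level} (R : CommutativeRing c ℓ) (u v : CommutativeRing.Carrier R)
                 (uv≈1 : CommutativeRing._≈_ R (CommutativeRing._*_ R u v) (CommutativeRing.1# R)) where
  open CommutativeRing R
  open FiniteSums R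
  open import Relation.Binary.Reasoning.Setoid setoid
  open import Algebra.Solver.Ring.NaturalCoefficients.Default commutativeSemiring
    using (solve; _:=_; _:+_; _:*_; con)
  open import Algebra.Properties.CommutativeSemigroup *-commutativeSemigroup using (x∙yz≈y∙xz)

  w : ℕ → Carrier
  w n = pow R u n + pow R v n

  c₁ : Carrier
  c₁ = twoCos R u v (+ 1)

  w-rec : ∀ n → c₁ * w (suc n) ≈ w (suc (suc n)) + w n
  w-rec n = begin
    (u * 1# + v * 1#) * (u * x + v * y)
      ≈⟨ *-congʳ (+-cong (*-identityʳ u) (*-identityʳ v)) ⟩
    (u + v) * (u * x + v * y)
      ≈⟨ solve 4 (λ u v x y → (u :+ v) :* (u :* x :+ v :* y)
                   := (u :* (u :* x) :+ v :* (v :* y)) :+ ((u :* v) :* y :+ (u :* v) :* x)) refl u v x y ⟩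
    (u * (u * x) + v * (v * y)) + ((u * v) * y + (u * v) * x)
      ≈⟨ +-congˡ (+-cong (cancel y) (cancel x)) ⟩
    w (suc (suc n)) + (y + x)
      ≈⟨ +-congˡ (+-comm y x) ⟩
    w (suc (suc n)) + w n ∎
    where
    x = pow R u n
    y = pow R v n
    cancel : ∀ z → (u * v) * z ≈ z
    cancel z = trans (*-congʳ uv≈1) (*-identityˡ z)

  r′ : ℕ → Carrier
  r′ = r R u v

  cosTerm : ℕ → ℕ → Carrier
  cosTerm t k = twoCos R u v (+ (2 *ℕ k) -ℤ + t)

  cosSum-step : ∀ t m → Σ (suc m) (cosTerm (suc (suc t))) ≈ w (suc (suc t)) + Σ m (cosTerm t)
  cosSum-step t m = trans (Σ-head m (cosTerm (suc (suc t))))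
    (+-cong (+-comm _ _) (Σ-cong m (λ k _ → reflexive (≡.cong (twoCos R u v) (2[k+1]-[t+2] k t)))))

  r-step : ∀ t → r′ (suc (suc t)) ≈ r′ t + w (suc (suc t))
  r-step t with t % 2 ℕ.≡ᵇ 1
  ... | true rewrite m/n≡1+[m∸n]/n {suc (suc (suc t))} {2} (s≤s (s≤s z≤n)) =
        trans (cosSum-step t (suc t / 2)) (+-comm _ _)
  ... | false rewrite m/n≡1+[m∸n]/n {suc (suc t)} {2} (s≤s (s≤s z≤n)) =
        trans (+-congˡ (cosSum-step t (t / 2))) (solve 2 (λ x y → con 1 :+ (x :+ y) := (con 1 :+ y) :+ x) refl _ _)

  r₋ : ℕ → Carrier
  r₋ zero = 0#
  r₋ (suc t) = r′ t

  r-suc : ∀ t → r′ (suc t) ≈ r₋ t + w (suc t)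
  r-suc zero = +-congˡ (+-comm _ _)
  r-suc (suc t) = r-step t

  -- The Chebyshev recurrence 2cos α · r_t = r_{t+1} + r_{t−1}; it is proved
  -- together with its companion 2cos α · r_{t−1} + 2cos(tα) = 2 r_t.
  r-rec : ∀ t → c₁ * r′ t ≈ r′ (suc t) + r₋ t
  r-rec-companion : ∀ t → c₁ * r₋ t + w t ≈ r′ t + r′ t

  r-rec zero = begin
    c₁ * (1# + 0#) ≈⟨ *-congˡ (+-identityʳ 1#) ⟩
    c₁ * 1#        ≈⟨ *-identityʳ c₁ ⟩
    c₁             ≈⟨ sym (+-identityˡ c₁) ⟩
    0# + w 1       ≈⟨ sym (r-suc 0) ⟩
    r′ 1           ≈⟨ sym (+-identityʳ _) ⟩
    r′ 1 + 0#      ∎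
  r-rec (suc t) = begin
    c₁ * r′ (suc t)                     ≈⟨ *-congˡ (r-suc t) ⟩
    c₁ * (r₋ t + w (suc t))             ≈⟨ distribˡ c₁ _ _ ⟩
    c₁ * r₋ t + c₁ * w (suc t)          ≈⟨ +-congˡ (w-rec t) ⟩
    c₁ * r₋ t + (w (suc (suc t)) + w t)
      ≈⟨ solve 3 (λ a b c → a :+ (b :+ c) := (a :+ c) :+ b) refl (c₁ * r₋ t) _ _ ⟩
    (c₁ * r₋ t + w t) + w (suc (suc t)) ≈⟨ +-congʳ (r-rec-companion t) ⟩
    (r′ t + r′ t) + w (suc (suc t))
      ≈⟨ solve 2 (λ a b → (a :+ a) :+ b := (a :+ b) :+ a) refl (r′ t) _ ⟩
    (r′ t + w (suc (suc t))) + r′ t     ≈⟨ +-congʳ (sym (r-step t)) ⟩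
    r′ (suc (suc t)) + r′ t             ∎

  r-rec-companion zero = begin
    c₁ * 0# + (1# + 1#)     ≈⟨ +-congʳ (zeroʳ c₁) ⟩
    0# + (1# + 1#)          ≈⟨ +-identityˡ _ ⟩
    1# + 1#                 ≈⟨ sym (+-cong (+-identityʳ 1#) (+-identityʳ 1#)) ⟩
    (1# + 0#) + (1# + 0#)   ∎
  r-rec-companion (suc t) = begin
    c₁ * r′ t + w (suc t)              ≈⟨ +-congʳ (r-rec t) ⟩
    (r′ (suc t) + r₋ t) + w (suc t)    ≈⟨ +-assoc _ _ _ ⟩
    r′ (suc t) + (r₋ t + w (suc t))    ≈⟨ +-congˡ (sym (r-suc t)) ⟩
    r′ (suc t) + r′ (suc t)            ∎

  c₁-r : ∀ t → c₁ * r′ t ≈ w (suc t) + (r₋ t + r₋ t)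
  c₁-r t = begin
    c₁ * r′ t                       ≈⟨ r-rec t ⟩
    r′ (suc t) + r₋ t               ≈⟨ +-congʳ (r-suc t) ⟩
    (r₋ t + w (suc t)) + r₋ t
      ≈⟨ solve 2 (λ a b → (a :+ b) :+ a := b :+ (a :+ a)) refl (r₋ t) _ ⟩
    w (suc t) + (r₋ t + r₋ t)       ∎

  -- Summation by parts against the Chebyshev recurrence: for any coefficients D,
  -- 2cos α · Σ_{i<m} D_{i+1} r_i + D_0 = Σ_{i≤m} D_i r_i + Σ_{i<m} D_{i+1} r_{i−1}.
  by-parts : ∀ m (D : ℕ → Carrier) →
    c₁ * Σ m (λ i → D (suc i) * r′ i) + D 0 ≈ Σ (suc m) (λ i → D i * r′ i) + Σ m (λ i → D (suc i) * r₋ i)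
  by-parts zero D = begin
    c₁ * 0# + D 0             ≈⟨ +-congʳ (zeroʳ c₁) ⟩
    0# + D 0                  ≈⟨ +-congˡ (sym (trans (*-congˡ (+-identityʳ 1#)) (*-identityʳ (D 0)))) ⟩
    0# + D 0 * (1# + 0#)      ≈⟨ sym (+-identityʳ _) ⟩
    (0# + D 0 * (1# + 0#)) + 0# ∎
  by-parts (suc m) D = begin
    c₁ * (A + x * r′ m) + D 0              ≈⟨ +-congʳ (distribˡ c₁ A _) ⟩
    (c₁ * A + c₁ * (x * r′ m)) + D 0
      ≈⟨ solve 3 (λ a y d → (a :+ y) :+ d := (a :+ d) :+ y) refl (c₁ * A) _ (D 0) ⟩
    (c₁ * A + D 0) + c₁ * (x * r′ m)       ≈⟨ +-cong (by-parts m D) (trans (x∙yz≈y∙xz c₁ x (r′ m)) (*-congˡ (r-rec m))) ⟩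
    (B + C) + x * (r′ (suc m) + r₋ m)      ≈⟨ +-congˡ (distribˡ x _ _) ⟩
    (B + C) + (x * r′ (suc m) + x * r₋ m)
      ≈⟨ solve 4 (λ b c y z → (b :+ c) :+ (y :+ z) := (b :+ y) :+ (c :+ z)) refl B C _ _ ⟩
    (B + x * r′ (suc m)) + (C + x * r₋ m)  ∎
    where
    x = D (suc m)
    A = Σ m (λ i → D (suc i) * r′ i)
    B = Σ (suc m) (λ i → D i * r′ i)
    C = Σ m (λ i → D (suc i) * r₋ i)

module RingIdentities {c ℓ : Level} (R : CommutativeRing c ℓ) where
  open CommutativeRing R
  open import Relation.Binary.Reasoning.Setoid setoid
  import Algebra.Properties.AbelianGroup +-abelianGroup as AbelianGroupProperties

  x-[x+y]≈-y : ∀ x y → x - (x + y) ≈ - y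
  x-[x+y]≈-y x y = begin
    x - (x + y)      ≈⟨ +-congˡ (sym (AbelianGroupProperties.⁻¹-∙-comm x y)) ⟩
    x + (- x + - y)  ≈⟨ sym (+-assoc x (- x) (- y)) ⟩
    (x - x) + - y    ≈⟨ +-congʳ (-‿inverseʳ x) ⟩
    0# + - y         ≈⟨ +-identityˡ (- y) ⟩
    - y              ∎

  x+y≈z⇒x-z≈-y : ∀ {x y z} → x + y ≈ z → x - z ≈ - y
  x+y≈z⇒x-z≈-y {x} {y} x+y≈z = trans (+-congˡ (-‿cong (sym x+y≈z))) (x-[x+y]≈-y x y)

  x≈y+z⇒x-z≈y : ∀ {x y z} → x ≈ y + z → x - z ≈ y
  x≈y+z⇒x-z≈y {x} {y} {z} x≈y+z = begin
    x - z          ≈⟨ +-congʳ x≈y+z ⟩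
    (y + z) - z    ≈⟨ +-assoc y z (- z) ⟩
    y + (z - z)    ≈⟨ +-congˡ (-‿inverseʳ z) ⟩
    y + 0#         ≈⟨ +-identityʳ y ⟩
    y              ∎

module Coefficients {c ℓ : Level} (R : CommutativeRing c ℓ) (u v : CommutativeRing.Carrier R)
                    (uv≈1 : CommutativeRing._≈_ R (CommutativeRing._*_ R u v) (CommutativeRing.1# R))
                    (M : ℕ) (d : ℕ → CommutativeRing.Carrier R) where
  open CommutativeRing R
  open FiniteSums R
  open Chebyshev R u v uv≈1
  open RingIdentities R
  open import Relation.Binary.Reasoning.Setoid setoid
  open import Algebra.Properties.CommutativeSemigroup *-commutativeSemigroup using (x∙yz≈y∙xz)

  Q : ℕ → Carrier
  Q = q R u v M d

  weight : ℕ → Carrier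
  weight t = if (0 <ᵇ t) ∧ (t <ᵇ suc M) then d t else 0#

  -- uniform description of q_t, valid also for t ≥ M (an empty sum)
  Q-as-sum : ∀ t → Q t ≈ Σ (M ∸ t) (λ i → d (suc t +ℕ i) * r′ i)
  Q-as-sum t with t ℕₚ.<? M
  ... | yes t<M = trans (reflexive (if-true (ℕₚ.<⇒<ᵇ t<M)))
        (Σ-cong (M ∸ t) (λ i _ → *-congˡ (reflexive (≡.cong r′ (ℕₚ.m+n∸m≡n t i)))))
  ... | no t≮M = trans (reflexive (if-false (λ t<ᵇM → t≮M (ℕₚ.<ᵇ⇒< t M t<ᵇM))))
        (Σ-length _ (≡.sym (ℕₚ.m≤n⇒m∸n≡0 (ℕₚ.≮⇒≥ t≮M))))

  Q-vanish : ∀ {t} → M ≤ t → Q t ≈ 0#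
  Q-vanish {t} M≤t = trans (Q-as-sum t) (Σ-length _ (ℕₚ.m≤n⇒m∸n≡0 M≤t))

  Q-suc-as-sum : ∀ t → Q (suc t) ≈ Σ (M ∸ t) (λ i → d (suc t +ℕ i) * r₋ i)
  Q-suc-as-sum t with M ∸ t in M∸t≡
  ... | zero = Q-vanish (ℕₚ.m≤n⇒m≤1+n (ℕₚ.m∸n≡0⇒m≤n M∸t≡))
  ... | suc m = begin
    Q (suc t)                                           ≈⟨ Q-as-sum (suc t) ⟩
    Σ (M ∸ suc t) (λ i → d (suc (suc t) +ℕ i) * r′ i)   ≈⟨ Σ-length _ M∸[t+1]≡m ⟩
    Σ m (λ i → d (suc (suc t) +ℕ i) * r′ i)
      ≈⟨ Σ-cong m (λ i _ → *-congʳ (reflexive (≡.cong d (≡.sym (ℕₚ.+-suc (suc t) i))))) ⟩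
    Σ m (λ i → d (suc t +ℕ suc i) * r′ i)               ≈⟨ sym (+-identityˡ _) ⟩
    0# + Σ m (λ i → d (suc t +ℕ suc i) * r′ i)          ≈⟨ +-congʳ (sym (zeroʳ _)) ⟩
    d (suc t +ℕ 0) * 0# + Σ m (λ i → d (suc t +ℕ suc i) * r′ i) ≈⟨ sym (Σ-head m _) ⟩
    Σ (suc m) (λ i → d (suc t +ℕ i) * r₋ i)             ∎
    where
    M∸[t+1]≡m : M ∸ suc t ≡ m
    M∸[t+1]≡m = ≡.trans (≡.sym (ℕₚ.pred[m∸n]≡m∸[1+n] M t)) (≡.cong ℕ.pred M∸t≡)

  entry-diagonal : c₁ * Q 0 - (Q 1 + Q 1) ≈ dα R u v M d
  entry-diagonal = x≈y+z⇒x-z≈y (begin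
    c₁ * Q 0                                               ≈⟨ *-congˡ (Q-as-sum 0) ⟩
    c₁ * Σ M (λ i → D i * r′ i)                            ≈⟨ sym (Σ-*ˡ M c₁ _) ⟩
    Σ M (λ i → c₁ * (D i * r′ i))                          ≈⟨ Σ-cong M (λ i _ → expand i) ⟩
    Σ M (λ i → D i * w (suc i) + (D i * r₋ i + D i * r₋ i)) ≈⟨ trans (Σ-+ M _ _) (+-congˡ (Σ-+ M _ _)) ⟩
    dα R u v M d + (Σ M (λ i → D i * r₋ i) + Σ M (λ i → D i * r₋ i))
      ≈⟨ +-congˡ (sym (+-cong (Q-suc-as-sum 0) (Q-suc-as-sum 0))) ⟩
    dα R u v M d + (Q 1 + Q 1)                              ∎)
    where
    D : ℕ → Carrier
    D i = d (suc i)
    expand : ∀ i → c₁ * (D i * r′ i) ≈ D i * w (suc i) + (D i * r₋ i + D i * r₋ i)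
    expand i = begin
      c₁ * (D i * r′ i)                       ≈⟨ x∙yz≈y∙xz c₁ (D i) (r′ i) ⟩
      D i * (c₁ * r′ i)                       ≈⟨ *-congˡ (c₁-r i) ⟩
      D i * (w (suc i) + (r₋ i + r₋ i))       ≈⟨ trans (distribˡ (D i) _ _) (+-congˡ (distribˡ (D i) _ _)) ⟩
      D i * w (suc i) + (D i * r₋ i + D i * r₋ i) ∎

  -- off-diagonal entries: 2cos α · q_{s+1} − q_s − q_{s+2} = −A(s+1), where A(s+1) is
  -- d_{s+1} within the bandwidth and 0 beyond it (then all three q vanish)
  entry-adjacent : ∀ s → c₁ * Q (suc s) - (Q s + Q (suc (suc s))) ≈ - weight (suc s)
  entry-adjacent s with s ℕₚ.<? M
  ... | no s≮M = begin
    c₁ * Q (suc s) - (Q s + Q (suc (suc s)))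
      ≈⟨ +-cong (trans (*-congˡ (Q-vanish (ℕₚ.m≤n⇒m≤1+n M≤s))) (zeroʳ c₁))
                (-‿cong (trans (+-cong (Q-vanish M≤s) (Q-vanish (ℕₚ.m≤n⇒m≤1+n (ℕₚ.m≤n⇒m≤1+n M≤s))))
                               (+-identityʳ 0#))) ⟩
    0# - 0#                    ≈⟨ +-identityˡ _ ⟩
    - 0#                       ≈⟨ -‿cong (sym (reflexive (if-false (λ s<ᵇM → s≮M (ℕₚ.<ᵇ⇒< s M s<ᵇM))))) ⟩
    - weight (suc s)           ∎
    where
    M≤s : M ≤ s
    M≤s = ℕₚ.≮⇒≥ s≮M
  ... | yes s<M = x+y≈z⇒x-z≈-y (begin
    c₁ * Q (suc s) + weight (suc s)
      ≈⟨ +-cong (*-congˡ Q[s+1]) (trans (reflexive (if-true (ℕₚ.<⇒<ᵇ s<M))) (reflexive (≡.cong d (≡.sym (ℕₚ.+-identityʳ (suc s)))))) ⟩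
    c₁ * Σ m (λ i → D (suc i) * r′ i) + D 0      ≈⟨ by-parts m D ⟩
    Σ (suc m) (λ i → D i * r′ i) + Σ m (λ i → D (suc i) * r₋ i)
      ≈⟨ sym (+-cong (trans (Q-as-sum s) (Σ-length _ M∸s≡1+m)) Q[s+2]) ⟩
    Q s + Q (suc (suc s))                          ∎)
    where
    m = M ∸ suc s
    M∸s≡1+m : M ∸ s ≡ suc m
    M∸s≡1+m = ℕₚ.+-∸-assoc 1 s<M
    D : ℕ → Carrier
    D i = d (suc s +ℕ i)
    reindex : ∀ (f : ℕ → Carrier) i → d (suc (suc s) +ℕ i) * f i ≈ D (suc i) * f i
    reindex f i = *-congʳ (reflexive (≡.cong d (≡.sym (ℕₚ.+-suc (suc s) i))))
    Q[s+1] : Q (suc s) ≈ Σ m (λ i → D (suc i) * r′ i)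
    Q[s+1] = trans (Q-as-sum (suc s)) (Σ-cong m (λ i _ → reindex r′ i))
    Q[s+2] : Q (suc (suc s)) ≈ Σ m (λ i → D (suc i) * r₋ i)
    Q[s+2] = trans (Q-suc-as-sum (suc s)) (Σ-cong m (λ i _ → reindex r₋ i))

module CycleLaplacian {c ℓ : Level} (R : CommutativeRing c ℓ) (N : ℕ) {{_ : NonZero N}} (3≤N : 3 ≤ N) where
  open CommutativeRing R
  open FiniteSums R
  open CycleGeometry N
  open import Relation.Binary.Reasoning.Setoid setoid
  import Algebra.Properties.Ring ring as RingProperties

  cycleWeight : ℕ → Carrier
  cycleWeight t = if t ≡ᵇ 1 then 1# else 0#

  ∥1∥≡1 : ∥ 1 ∥ ≡ 1
  ∥1∥≡1 = ∥∥-small (ℕₚ.≤-trans (s≤s (s≤s z≤n)) 3≤N)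

  -- Σ_{e<N} [∥e∥ = 1] g(e) = g(1) + g(N − 1): the residues at norm 1 are exactly 1 and N − 1
  Σ-norm-one : (g : ℕ → Carrier) → Σ N (λ e → cycleWeight ∥ e ∥ * g e) ≈ g 1 + g (N ∸ 1)
  Σ-norm-one g = begin
    Σ N h                                                ≈⟨ Σ-length h N≡3+n ⟩
    Σ (suc (suc n)) h + h (suc (suc n))
      ≈⟨ +-congʳ (trans (Σ-head (suc n) h) (+-congˡ (Σ-head n (h ∘ suc)))) ⟩
    (h 0 + (h 1 + Σ n (λ i → h (suc (suc i))))) + h (suc (suc n))
      ≈⟨ +-cong (+-cong (zeroˡ (g 0)) (+-cong h1 (Σ-zero n middle))) hlast ⟩
    (0# + (g 1 + 0#)) + g (N ∸ 1)                        ≈⟨ +-congʳ (trans (+-identityˡ _) (+-identityʳ _)) ⟩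
    g 1 + g (N ∸ 1)                                      ∎
    where
    h : ℕ → Carrier
    h e = cycleWeight ∥ e ∥ * g e
    n = N ∸ 3
    N≡3+n : N ≡ 3 +ℕ n
    N≡3+n = ≡.sym (ℕₚ.m+[n∸m]≡n 3≤N)
    weight-one : ∀ {e} → ∥ e ∥ ≡ 1 → h e ≈ g e
    weight-one ∥e∥≡1 = trans (*-congʳ (reflexive (≡.cong cycleWeight ∥e∥≡1))) (*-identityˡ _)
    h1 : h 1 ≈ g 1
    h1 = weight-one ∥1∥≡1
    middle : ∀ i → i < n → h (suc (suc i)) ≈ 0#
    middle i i<n = trans (*-congʳ (reflexive (far (ℕₚ.⊓-glb (s≤s (s≤s z≤n)) 2≤N∸[2+i])))) (zeroˡ _)
      where
      2≤N∸[2+i] : 2 ≤ N ∸ suc (suc i)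
      2≤N∸[2+i] = ℕₚ.m+n≤o⇒m≤o∸n 2 (≡.subst (suc (suc (suc (suc i))) ≤_) (≡.sym N≡3+n) (s≤s (s≤s (s≤s i<n))))
      far : ∀ {t} → 2 ≤ t → cycleWeight t ≡ 0#
      far (s≤s (s≤s _)) = ≡.refl
    hlast : h (suc (suc n)) ≈ g (N ∸ 1)
    hlast = trans (reflexive (≡.cong h (≡.sym (≡.cong (_∸ 1) N≡3+n))))
                  (weight-one (≡.trans (∥∥-reflect (ℕₚ.≤-trans (s≤s z≤n) 3≤N)) ∥1∥≡1))

  Σ-neighbours : ∀ {a} → a < N → (z : ℕ → Carrier) →
    Σ N (λ b → cycleWeight (dist a b) * z b) ≈ z ((a +ℕ 1) % N) + z ((a +ℕ (N ∸ 1)) % N)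
  Σ-neighbours {a} a<N z = begin
    Σ N (λ b → cycleWeight (dist a b) * z b)                             ≈⟨ Σ-rotate N a<N _ ⟩
    Σ N (λ e → cycleWeight (dist a ((a +ℕ e) % N)) * z ((a +ℕ e) % N))
      ≈⟨ Σ-cong N (λ e e<N → *-congʳ (reflexive (≡.cong cycleWeight (dist-rotate a<N e<N)))) ⟩
    Σ N (λ e → cycleWeight ∥ e ∥ * z ((a +ℕ e) % N))                      ≈⟨ Σ-norm-one _ ⟩
    z ((a +ℕ 1) % N) + z ((a +ℕ (N ∸ 1)) % N)                            ∎

  cycle-row : (x : Carrier) (i : Fin N) (z : ℕ → Carrier) → let a = toℕ i in
    ΣFin R (λ j → _⊖_ R (scalarI R x) (cycleAdj R N) i j * z (toℕ j))
      ≈ x * z a - (z ((a +ℕ 1) % N) + z ((a +ℕ (N ∸ 1)) % N))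
  cycle-row x i z = begin
    ΣFin R {N} (λ j → F (toℕ j))                                    ≈⟨ ΣFin-toℕ N F ⟩
    Σ N F                                                         ≈⟨ Σ-cong N (λ b _ → split b) ⟩
    Σ N (λ b → kronecker a b x * z b + - (cycleWeight (dist a b) * z b)) ≈⟨ Σ-+ N _ _ ⟩
    Σ N (λ b → kronecker a b x * z b) + Σ N (λ b → - (cycleWeight (dist a b) * z b))
      ≈⟨ +-cong (Σ-kronecker N a<N x z) (trans (Σ-neg N _) (-‿cong (Σ-neighbours a<N z))) ⟩
    x * z a - (z ((a +ℕ 1) % N) + z ((a +ℕ (N ∸ 1)) % N))          ∎
    where
    a = toℕ i
    a<N = Finₚ.toℕ<n i
    F : ℕ → Carrier
    F b = (kronecker a b x - cycleWeight (dist a b)) * z b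
    split : ∀ b → F b ≈ kronecker a b x * z b + - (cycleWeight (dist a b) * z b)
    split b = trans (distribʳ (z b) _ _) (+-congˡ (sym (RingProperties.-‿distribˡ-* _ (z b))))

module Assembly {c ℓ : Level} (R : CommutativeRing c ℓ) (N : ℕ) {{_ : NonZero N}} (3≤N : 3 ≤ N)
                (u v : CommutativeRing.Carrier R)
                (uv≈1 : CommutativeRing._≈_ R (CommutativeRing._*_ R u v) (CommutativeRing.1# R))
                (M : ℕ) (d : ℕ → CommutativeRing.Carrier R) (M+M<N : M +ℕ M < N) where
  open CommutativeRing R
  open FiniteSums R
  open CycleGeometry N
  open CycleLaplacian R N 3≤N
  open Chebyshev R u v uv≈1 using (c₁)
  open Coefficients R u v uv≈1 M d
  open import Relation.Binary.Reasoning.Setoid setoid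
  import Algebra.Properties.AbelianGroup +-abelianGroup as AbelianGroupProperties

  SamePair-+ : ∀ (f : ℕ → Carrier) {p q x y} → SamePair p q x y → f p + f q ≈ f x + f y
  SamePair-+ f (inj₁ (≡.refl , ≡.refl)) = refl
  SamePair-+ f (inj₂ (≡.refl , ≡.refl)) = +-comm _ _

  Q-norm-suc : ∀ {s} → s +ℕ s ≤ N → Q ∥ suc s ∥ ≈ Q (suc s)
  Q-norm-suc s+s≤N with norm-suc-wraps-beyond s+s≤N M+M<N
  ... | inj₁ ∥s+1∥≡s+1 = reflexive (≡.cong Q ∥s+1∥≡s+1)
  ... | inj₂ (M≤s+1 , M≤∥s+1∥) = trans (Q-vanish M≤∥s+1∥) (sym (Q-vanish M≤s+1))

  entry-off-diagonal : ∀ {s s⁺ s⁻} → 0 < s → s +ℕ s ≤ N → SamePair s⁺ s⁻ (∥ suc s ∥) (s ∸ 1) →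
    c₁ * Q s - (Q s⁺ + Q s⁻) ≈ - weight s
  entry-off-diagonal {suc s} {s⁺} {s⁻} _ s+s≤N pair = trans (+-congˡ (-‿cong neighbour-terms)) (entry-adjacent s)
    where
    neighbour-terms : Q s⁺ + Q s⁻ ≈ Q s + Q (suc (suc s))
    neighbour-terms = trans (SamePair-+ Q pair) (trans (+-congʳ (Q-norm-suc s+s≤N)) (+-comm _ _))

  column : ℕ → ℕ → Carrier
  column b x = Q (dist x b)

  entry-ℕ : ∀ {a b} → a < N → b < N →
    kronecker a b (dα R u v M d) - weight (dist a b)
      ≈ c₁ * column b a - (column b ((a +ℕ 1) % N) + column b ((a +ℕ (N ∸ 1)) % N))
  entry-ℕ {a} {b} a<N b<N with a ℕₚ.≟ b
  ... | yes ≡.refl = begin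
    kronecker a a (dα R u v M d) - weight (dist a a)
      ≈⟨ +-cong (kronecker-≡ a _) (-‿cong (reflexive (≡.cong weight (dist-self a)))) ⟩
    dα R u v M d - 0#                  ≈⟨ trans (+-congˡ AbelianGroupProperties.ε⁻¹≈ε) (+-identityʳ _) ⟩
    dα R u v M d                       ≈⟨ sym entry-diagonal ⟩
    c₁ * Q 0 - (Q 1 + Q 1)
      ≈⟨ sym (+-cong (*-congˡ (reflexive (≡.cong Q (dist-self a))))
                     (-‿cong (+-cong (reflexive (≡.cong Q at-distance-one⁺)) (reflexive (≡.cong Q at-distance-one⁻))))) ⟩
    c₁ * column b a - (column b ((a +ℕ 1) % N) + column b ((a +ℕ (N ∸ 1)) % N)) ∎
    where
    at-distance-one⁺ : dist ((a +ℕ 1) % N) a ≡ 1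
    at-distance-one⁺ = ≡.trans (proj₁ (neighbours-of-self a<N)) ∥1∥≡1
    at-distance-one⁻ : dist ((a +ℕ (N ∸ 1)) % N) a ≡ 1
    at-distance-one⁻ = ≡.trans (proj₂ (neighbours-of-self a<N)) ∥1∥≡1
  ... | no a≢b with neighbours-of-other a<N b<N a≢b
  ...   | 0<s , s+s≤N , pair = begin
    kronecker a b (dα R u v M d) - weight (dist a b) ≈⟨ +-congʳ (kronecker-≢ _ a≢b) ⟩
    0# - weight (dist a b)                           ≈⟨ +-identityˡ _ ⟩
    - weight (dist a b)                              ≈⟨ sym (entry-off-diagonal 0<s s+s≤N pair) ⟩
    c₁ * column b a - (column b ((a +ℕ 1) % N) + column b ((a +ℕ (N ∸ 1)) % N)) ∎

  entry : (i k : Fin N) → Lα R N M d u v i k ≈ _⊛_ R (LCα R N u v) (Pα R N M d u v) i k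
  entry i k = trans (entry-ℕ (Finₚ.toℕ<n i) (Finₚ.toℕ<n k)) (sym (cycle-row c₁ i (column (toℕ k))))

lemma4p9 : ∀ {c ℓ : Level} (R : CommutativeRing c ℓ) →
    let open CommutativeRing R in
    (N M : ℕ) (S : List ℕ) (d : ℕ → Carrier) →
    (∀ s → s ∈ S → 1 ≤ s × s ≤ M) → M ∈ S → M +ℕ M < N →
    Connected N S →
    (∀ j → j ∉ S → d j ≈ 0#) →
    (u v : Carrier) → u * v ≈ 1# →
    _≈M_ R (Lα R N M d u v) (_⊛_ R (LCα R N u v) (Pα R N M d u v))
lemma4p9 R N M S d S⊆[1,M] M∈S M+M<N _ _ u v uv≈1 =
  Assembly.entry R N {{>-nonZero (ℕₚ.≤-trans (s≤s z≤n) 3≤N)}} 3≤N u v uv≈1 M d M+M<N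
  where
  -- the bandwidth M is positive, so the cycle has at least 2M + 1 ≥ 3 vertices
  3≤N : 3 ≤ N
  3≤N = ℕₚ.≤-trans (s≤s (ℕₚ.+-mono-≤ 1≤M 1≤M)) M+M<N
    where
    1≤M : 1 ≤ M
    1≤M = proj₁ (S⊆[1,M] M M∈S)
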